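{- For every simply typed $\lambda$-term $M$: (1) if $*;M^{\mathrm n}\to^* u_*$ in the ptq-calculus, then $M\to^*\lfloor u_*\rfloor$ in the Call-by-Name $\lambda$-calculus; (2) if $M^{\mathrm v}\,*\to^*u_*$ in the ptq-calculus, then $M\to^*\lfloor u_*\rfloor$ in the Call-by-Value $\lambda$-calculus.
   Context: Call-by-Name and Call-by-Value $\lambda$-calculi (lazy, no reduction under $\lambda$; a value $V$ is a variable or an abstraction). CbN one-step: $(\lambda x.M)N\to M[N/x]$, and $M\to M_1$ implies $MN\to M_1N$. CbV one-step (argument evaluated first): $(\lambda x.M)V\to M[V/x]$ for $V$ a value; $N\to N_1$ implies $MN\to MN_1$; $M\to M_1$ implies $MV\to M_1V$ for $V$ a value. $\to^*$ is reflexive–transitive closure. ptq-calculus: p-variables (identified with $\lambda$-variables), a t-variable $k$, a constant $*$; p-terms $p::=x\mid\lambda\langle x,k\rangle.u\mid\lambda k.u$; t-terms $t::=*\mid k\mid\langle p,t\rangle\mid\lambda x.u$; q-terms $q::=\overline{\lambda}k.u$; e-terms $u::=t;p\mid q\,t$; binders $\lambda\langle x,k\rangle$ (binds $x,k$), $\lambda k,\overline\lambda k$ (bind $k$), $\lambda x$ (binds $x$); terms modulo $\alpha$-conversion. For $u$ with $k$ free, $u_*:=u[*/k]$. Reduction (on t-closed e-terms, top level only): $*;\lambda k.u\to u[*/k]$; $\langle p,t_*\rangle;\lambda k.u\to u[\langle p,t_*\rangle/k]$; $\langle p,t_*\rangle;\lambda\langle x,k\rangle.u\to u[p/x,t_*/k]$;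 $(\lambda x.u_*);p\to u_*[p/x]$; $(\overline\lambda k.u)\,t_*\to u[t_*/k]$. Readback into $\lambda$-terms possibly containing a hole constant $\Box$, with $M\cdot N:=M[N/\Box]$: $\lfloor *\rfloor=\Box$; $\lfloor x\rfloor=x$; $\lfloor\langle p,t_*\rangle\rfloor=\lfloor t_*\rfloor\cdot(\Box\,\lfloor p\rfloor)$; $\lfloor\lambda\langle x,k\rangle.u\rfloor=\lambda x.\lfloor u_*\rfloor$; $\lfloor\lambda x.u_*\rfloor=\lfloor u_*\rfloor[\Box/x]$; $\lfloor\lambda k.u\rfloor=\lfloor u_*\rfloor$; $\lfloor\overline\lambda k.u\rfloor=\lfloor u_*\rfloor$; $\lfloor t_*;p\rfloor=\lfloor t_*\rfloor\cdot\lfloor p\rfloor$; $\lfloor q\,t_*\rfloor=\lfloor t_*\rfloor\cdot\lfloor q\rfloor$. Translations: $x^{\mathrm n}=x$, $(\lambda x.M)^{\mathrm n}=\lambda\langle x,k\rangle.k;M^{\mathrm n}$, $(MN)^{\mathrm n}=\lambda k.\langle N^{\mathrm n},k\rangle;M^{\mathrm n}$; $x^{\mathrm v}=\overline\lambda k.k;x$, $(\lambda x.M)^{\mathrm v}=\overline\lambda k.k;(\lambda\langle x,k\rangle.M^{\mathrm v}k)$, $(MN)^{\mathrm v}=\overline\lambda k.N^{\mathrm v}(\lambda x.M^{\mathrm v}\langle x,k\rangle)$ ($x$ fresh). -}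

module Defs where

open import Data.Nat using (ℕ; zero; suc; pred; _<ᵇ_; _≡ᵇ_)
open import Data.Bool using (Bool; true; false; if_then_else_; _∨_)
open import Data.List using (List; []; _∷_)
open import Relation.Binary.PropositionalEquality using (_≡_)
open import Relation.Binary.Construct.Closure.ReflexiveTransitive using (Star)

-- λ-terms (de Bruijn indices), possibly containing the hole constant □

data Tm : Set where
  var  : ℕ → Tm
  lam  : Tm → Tm
  _·_  : Tm → Tm → Tm
  hole : Tm

infixl 7 _·_

shiftTm : ℕ → Tm → Tm
shiftTm c (var x) = if x <ᵇ c then var x else var (suc x)
shiftTm c (lam M) = lam (shiftTm (suc c) M)
shiftTm c (M · N) = shiftTm c M · shiftTm c N
shiftTm c hole    = hole

substTm : ℕ → Tm → Tm → Tm
substTm j N (var x) =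
  if x <ᵇ j then var x else (if x ≡ᵇ j then N else var (pred x))
substTm j N (lam M) = lam (substTm (suc j) (shiftTm 0 N) M)
substTm j N (M₁ · M₂) = substTm j N M₁ · substTm j N M₂
substTm j N hole    = hole

_[_/0] : Tm → Tm → Tm
M [ N /0] = substTm 0 N M

-- M · N := M[N/□]  (hole filling, as a substitution for the constant □)
plug : Tm → Tm → Tm
plug (var x) N = var x
plug (lam M) N = lam (plug M (shiftTm 0 N))
plug (M₁ · M₂) N = plug M₁ N · plug M₂ N
plug hole N    = N

data Ty : Set where
  base : ℕ → Ty
  _⇒_  : Ty → Ty → Ty

infixr 6 _⇒_

Ctx : Set
Ctx = List Ty

data _∋_∶_ : Ctx → ℕ → Ty → Set where
  here  : ∀ {Γ A} → (A ∷ Γ) ∋ zero ∶ A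
  there : ∀ {Γ A B x} → Γ ∋ x ∶ A → (B ∷ Γ) ∋ suc x ∶ A

-- simply typed λ-terms (no rule for □: typed terms are hole-free)
data _⊢_∶_ : Ctx → Tm → Ty → Set where
  ⊢var : ∀ {Γ x A} → Γ ∋ x ∶ A → Γ ⊢ var x ∶ A
  ⊢lam : ∀ {Γ M A B} → (A ∷ Γ) ⊢ M ∶ B → Γ ⊢ lam M ∶ (A ⇒ B)
  ⊢app : ∀ {Γ M N A B} → Γ ⊢ M ∶ (A ⇒ B) → Γ ⊢ N ∶ A → Γ ⊢ M · N ∶ B

data Value : Tm → Set where
  vvar : ∀ {x} → Value (var x)
  vlam : ∀ {M} → Value (lam M)

data _→N_ : Tm → Tm → Set where
  βN   : ∀ {M N} → (lam M · N) →N (M [ N /0])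
  appN : ∀ {M M₁ N} → M →N M₁ → (M · N) →N (M₁ · N)

data _→V_ : Tm → Tm → Set where
  βV    : ∀ {M V} → Value V → (lam M · V) →V (M [ V /0])
  argV  : ∀ {M N N₁} → N →V N₁ → (M · N) →V (M · N₁)
  funV  : ∀ {M M₁ V} → Value V → M →V M₁ → (M · V) →V (M₁ · V)

_→N*_ : Tm → Tm → Set
_→N*_ = Star _→N_

_→V*_ : Tm → Tm → Set
_→V*_ = Star _→V_

-- ptq-calculus.  p-variables are de Bruijn indices; the single t-variable
-- k is the constructor `kv`, referring to the innermost enclosing
-- k-binder (λ⟨x,k⟩, λk, λ̄k).  λ⟨x,k⟩ and λx bind the p-variable index 0.

mutual
  data P : Set where
    pvar  : ℕ → P
    λ⟨x,k⟩ : E → P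
    λk    : E → P

  data T : Set where
    ⋆    : T
    kv   : T
    ⟨_,_⟩ : P → T → T
    λx   : E → T

  data Q : Set where
    λ̄k : E → Q

  data E : Set where
    _⨾_  : T → P → E
    _∙_  : Q → T → E

mutual
  shP : ℕ → P → P
  shP c (pvar x) = if x <ᵇ c then pvar x else pvar (suc x)
  shP c (λ⟨x,k⟩ u) = λ⟨x,k⟩ (shE (suc c) u)
  shP c (λk u) = λk (shE c u)

  shT : ℕ → T → T
  shT c ⋆ = ⋆
  shT c kv = kv
  shT c ⟨ p , t ⟩ = ⟨ shP c p , shT c t ⟩
  shT c (λx u) = λx (shE (suc c) u)

  shQ : ℕ → Q → Q
  shQ c (λ̄k u) = λ̄k (shE c u)

  shE : ℕ → E → E
  shE c (t ⨾ p) = shT c t ⨾ shP c p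
  shE c (q ∙ t) = shQ c q ∙ shT c t

mutual
  sbP : ℕ → P → P → P
  sbP j r (pvar x) =
    if x <ᵇ j then pvar x else (if x ≡ᵇ j then r else pvar (pred x))
  sbP j r (λ⟨x,k⟩ u) = λ⟨x,k⟩ (sbE (suc j) (shP 0 r) u)
  sbP j r (λk u) = λk (sbE j r u)

  sbT : ℕ → P → T → T
  sbT j r ⋆ = ⋆
  sbT j r kv = kv
  sbT j r ⟨ p , t ⟩ = ⟨ sbP j r p , sbT j r t ⟩
  sbT j r (λx u) = λx (sbE (suc j) (shP 0 r) u)

  sbQ : ℕ → P → Q → Q
  sbQ j r (λ̄k u) = λ̄k (sbE j r u)

  sbE : ℕ → P → E → E
  sbE j r (t ⨾ p) = sbT j r t ⨾ sbP j r p
  sbE j r (q ∙ t) = sbQ j r q ∙ sbT j r t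

_[_/x] : E → P → E
u [ p /x] = sbE 0 p u

mutual
  skP : T → P → P
  skP s (pvar x) = pvar x
  skP s (λ⟨x,k⟩ u) = λ⟨x,k⟩ u
  skP s (λk u) = λk u

  skT : T → T → T
  skT s ⋆ = ⋆
  skT s kv = s
  skT s ⟨ p , t ⟩ = ⟨ skP s p , skT s t ⟩
  skT s (λx u) = λx (skE (shT 0 s) u)

  skQ : T → Q → Q
  skQ s (λ̄k u) = λ̄k u

  skE : T → E → E
  skE s (t ⨾ p) = skT s t ⨾ skP s p
  skE s (q ∙ t) = skQ s q ∙ skT s t

_[_/k] : E → T → E
u [ s /k] = skE s u

mutual
  fkP : P → Bool
  fkP (pvar x) = false
  fkP (λ⟨x,k⟩ u) = false
  fkP (λk u) = false

  fkT : T → Bool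
  fkT ⋆ = false
  fkT kv = true
  fkT ⟨ p , t ⟩ = fkP p ∨ fkT t
  fkT (λx u) = fkE u

  fkQ : Q → Bool
  fkQ (λ̄k u) = false

  fkE : E → Bool
  fkE (t ⨾ p) = fkT t ∨ fkP p
  fkE (q ∙ t) = fkQ q ∨ fkT t

TClosed : T → Set
TClosed t = fkT t ≡ false

-- one-step ptq reduction (top level only)
data _⟶_ : E → E → Set where
  r-⋆λk   : ∀ {u} → (⋆ ⨾ λk u) ⟶ (u [ ⋆ /k])
  r-pairλk : ∀ {p t u} → TClosed t →
             (⟨ p , t ⟩ ⨾ λk u) ⟶ (u [ ⟨ p , t ⟩ /k])
  r-pairλxk : ∀ {p t u} → TClosed t →
             (⟨ p , t ⟩ ⨾ λ⟨x,k⟩ u) ⟶ ((u [ p /x]) [ t /k])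
  r-λx    : ∀ {u p} → TClosed (λx u) → (λx u ⨾ p) ⟶ (u [ p /x])
  r-λ̄k    : ∀ {u t} → TClosed t → (λ̄k u ∙ t) ⟶ (u [ t /k])

_⟶*_ : E → E → Set
_⟶*_ = Star _⟶_

-- Readback.  ⌊k⌋ = □ so that ⌊u⌋ = ⌊u[*/k]⌋ = ⌊u_*⌋.

mutual
  ⌊_⌋P : P → Tm
  ⌊ pvar x ⌋P = var x
  ⌊ λ⟨x,k⟩ u ⌋P = lam ⌊ u ⌋E
  ⌊ λk u ⌋P = ⌊ u ⌋E

  ⌊_⌋T : T → Tm
  ⌊ ⋆ ⌋T = hole
  ⌊ kv ⌋T = hole
  ⌊ ⟨ p , t ⟩ ⌋T = plug ⌊ t ⌋T (hole · ⌊ p ⌋P)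
  ⌊ λx u ⌋T = ⌊ u ⌋E [ hole /0]

  ⌊_⌋Q : Q → Tm
  ⌊ λ̄k u ⌋Q = ⌊ u ⌋E

  ⌊_⌋E : E → Tm
  ⌊ t ⨾ p ⌋E = plug ⌊ t ⌋T ⌊ p ⌋P
  ⌊ q ∙ t ⌋E = plug ⌊ t ⌋T ⌊ q ⌋Q

_ⁿ : Tm → P
var x ⁿ = pvar x
lam M ⁿ = λ⟨x,k⟩ (kv ⨾ (M ⁿ))
(M · N) ⁿ = λk (⟨ N ⁿ , kv ⟩ ⨾ (M ⁿ))
hole ⁿ = pvar 0   -- irrelevant: source terms are typed, hence hole-free

_ᵛ : Tm → Q
var x ᵛ = λ̄k (kv ⨾ pvar x)
lam M ᵛ = λ̄k (kv ⨾ λ⟨x,k⟩ ((M ᵛ) ∙ kv))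
(M · N) ᵛ = λ̄k ((N ᵛ) ∙ λx (shQ 0 (M ᵛ) ∙ ⟨ pvar 0 , kv ⟩))
hole ᵛ = λ̄k (kv ⨾ pvar 0)   -- irrelevant: source terms are hole-free

-- Both translations are simulations.  Every ptq term reachable from the image of M
-- is the image of a λ-configuration: a term N (in CbV possibly a value being
-- returned) together with a t-term encoding an evaluation context C, as a stack of
-- pending arguments in CbN and as a continuation in CbV; its readback is C[N].
-- A ptq step either moves a frame between the term and its context, leaving C[N]
-- unchanged, or contracts a β-redex in evaluation position, which is one step of
-- the λ-calculus.  So M →* C[N] is invariant under ptq reduction.  The typing
-- hypothesis only serves to know that M contains no hole.

module Submission where

open import Data.Bool using (true; false)
open import Data.Nat using (zero; suc; pred; _<ᵇ_; _≡ᵇ_; _<_; _≤_; z≤n; s≤s)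
open import Data.Nat.Properties
  using (<-≤-connex; <-cmp; ≤-refl; ≤-trans; <-≤-trans; <⇒≤; m≤n⇒m≤1+n)
open import Data.Product using (_×_; _,_)
open import Data.Sum using (inj₁; inj₂)
open import Relation.Binary using (tri<; tri≈; tri>)
open import Relation.Binary.PropositionalEquality
open ≡-Reasoning
open import Relation.Binary.Construct.Closure.ReflexiveTransitive using (Star; ε; _◅_; _◅◅_)

open import Defs

preserved-by-Star : ∀ {A : Set} {R : A → A → Set} (P : A → Set) →
  (∀ {x y} → P x → R x y → P y) → ∀ {x y} → P x → Star R x y → P y
preserved-by-Star P step px ε        = px
preserved-by-Star P step px (r ◅ rs) = preserved-by-Star P step (step px r) rs

-- de Bruijn shifting and substitution

<ᵇ-true : ∀ {x j} → x < j → (x <ᵇ j) ≡ true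
<ᵇ-true {zero}  {suc j} _         = refl
<ᵇ-true {suc x} {suc j} (s≤s x<j) = <ᵇ-true x<j

<ᵇ-false : ∀ {x j} → j ≤ x → (x <ᵇ j) ≡ false
<ᵇ-false {x}     {zero}  _         = refl
<ᵇ-false {suc x} {suc j} (s≤s j≤x) = <ᵇ-false j≤x

≡ᵇ-refl : ∀ x → (x ≡ᵇ x) ≡ true
≡ᵇ-refl zero    = refl
≡ᵇ-refl (suc x) = ≡ᵇ-refl x

≡ᵇ-false : ∀ {x j} → j < x → (x ≡ᵇ j) ≡ false
≡ᵇ-false {suc x} {zero}  _         = refl
≡ᵇ-false {suc x} {suc j} (s≤s j<x) = ≡ᵇ-false j<x

shiftTm-var-< : ∀ {c x} → x < c → shiftTm c (var x) ≡ var x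
shiftTm-var-< x<c rewrite <ᵇ-true x<c = refl

shiftTm-var-≥ : ∀ {c x} → c ≤ x → shiftTm c (var x) ≡ var (suc x)
shiftTm-var-≥ c≤x rewrite <ᵇ-false c≤x = refl

substTm-var-< : ∀ {j N x} → x < j → substTm j N (var x) ≡ var x
substTm-var-< x<j rewrite <ᵇ-true x<j = refl

substTm-var-≡ : ∀ {j N} → substTm j N (var j) ≡ N
substTm-var-≡ {j} rewrite <ᵇ-false (≤-refl {j}) | ≡ᵇ-refl j = refl

substTm-var-> : ∀ {j N x} → j < x → substTm j N (var x) ≡ var (pred x)
substTm-var-> j<x rewrite <ᵇ-false (<⇒≤ j<x) | ≡ᵇ-false j<x = refl

shiftTm-comm : ∀ {c d} M → c ≤ d →
  shiftTm (suc d) (shiftTm c M) ≡ shiftTm c (shiftTm d M)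
shiftTm-comm {c} {d} (var x) c≤d with <-≤-connex x c | <-≤-connex x d
... | inj₁ x<c | _ = begin
  shiftTm (suc d) (shiftTm c (var x)) ≡⟨ cong (shiftTm (suc d)) (shiftTm-var-< x<c) ⟩
  shiftTm (suc d) (var x)             ≡⟨ shiftTm-var-< (m≤n⇒m≤1+n x<d) ⟩
  var x                               ≡⟨ shiftTm-var-< x<c ⟨
  shiftTm c (var x)                   ≡⟨ cong (shiftTm c) (shiftTm-var-< x<d) ⟨
  shiftTm c (shiftTm d (var x))       ∎
  where x<d = <-≤-trans x<c c≤d
... | inj₂ c≤x | inj₁ x<d = begin
  shiftTm (suc d) (shiftTm c (var x)) ≡⟨ cong (shiftTm (suc d)) (shiftTm-var-≥ c≤x) ⟩
  shiftTm (suc d) (var (suc x))       ≡⟨ shiftTm-var-< (s≤s x<d) ⟩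
  var (suc x)                         ≡⟨ shiftTm-var-≥ c≤x ⟨
  shiftTm c (var x)                   ≡⟨ cong (shiftTm c) (shiftTm-var-< x<d) ⟨
  shiftTm c (shiftTm d (var x))       ∎
... | inj₂ c≤x | inj₂ d≤x = begin
  shiftTm (suc d) (shiftTm c (var x)) ≡⟨ cong (shiftTm (suc d)) (shiftTm-var-≥ c≤x) ⟩
  shiftTm (suc d) (var (suc x))       ≡⟨ shiftTm-var-≥ (s≤s d≤x) ⟩
  var (suc (suc x))                   ≡⟨ shiftTm-var-≥ (m≤n⇒m≤1+n c≤x) ⟨
  shiftTm c (var (suc x))             ≡⟨ cong (shiftTm c) (shiftTm-var-≥ d≤x) ⟨
  shiftTm c (shiftTm d (var x))       ∎
shiftTm-comm (lam M)   c≤d = cong lam (shiftTm-comm M (s≤s c≤d))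
shiftTm-comm (M₁ · M₂) c≤d = cong₂ _·_ (shiftTm-comm M₁ c≤d) (shiftTm-comm M₂ c≤d)
shiftTm-comm hole      c≤d = refl

shiftTm-shiftTm₀ : ∀ {c} M → shiftTm (suc c) (shiftTm 0 M) ≡ shiftTm 0 (shiftTm c M)
shiftTm-shiftTm₀ M = shiftTm-comm M z≤n

substTm-shiftTm : ∀ {j N} M → substTm j N (shiftTm j M) ≡ M
substTm-shiftTm {j} {N} (var x) with <-≤-connex x j
... | inj₁ x<j = trans (cong (substTm j N) (shiftTm-var-< x<j)) (substTm-var-< x<j)
... | inj₂ j≤x = trans (cong (substTm j N) (shiftTm-var-≥ j≤x)) (substTm-var-> (s≤s j≤x))
substTm-shiftTm (lam M)   = cong lam (substTm-shiftTm M)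
substTm-shiftTm (M₁ · M₂) = cong₂ _·_ (substTm-shiftTm M₁) (substTm-shiftTm M₂)
substTm-shiftTm hole      = refl

shiftTm-substTm : ∀ {c j N} M → c ≤ j →
  substTm (suc j) (shiftTm c N) (shiftTm c M) ≡ shiftTm c (substTm j N M)
shiftTm-substTm {c} {j} {N} (var x) c≤j with <-≤-connex x c | <-cmp x j
... | inj₁ x<c | _ = begin
  substTm (suc j) (shiftTm c N) (shiftTm c (var x)) ≡⟨ cong (substTm (suc j) _) (shiftTm-var-< x<c) ⟩
  substTm (suc j) (shiftTm c N) (var x)             ≡⟨ substTm-var-< (m≤n⇒m≤1+n x<j) ⟩
  var x                                             ≡⟨ shiftTm-var-< x<c ⟨
  shiftTm c (var x)                                 ≡⟨ cong (shiftTm c) (substTm-var-< x<j) ⟨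
  shiftTm c (substTm j N (var x))                   ∎
  where x<j = <-≤-trans x<c c≤j
... | inj₂ c≤x | tri< x<j _ _ = begin
  substTm (suc j) (shiftTm c N) (shiftTm c (var x)) ≡⟨ cong (substTm (suc j) _) (shiftTm-var-≥ c≤x) ⟩
  substTm (suc j) (shiftTm c N) (var (suc x))       ≡⟨ substTm-var-< (s≤s x<j) ⟩
  var (suc x)                                       ≡⟨ shiftTm-var-≥ c≤x ⟨
  shiftTm c (var x)                                 ≡⟨ cong (shiftTm c) (substTm-var-< x<j) ⟨
  shiftTm c (substTm j N (var x))                   ∎
... | inj₂ c≤x | tri≈ _ refl _ = begin
  substTm (suc j) (shiftTm c N) (shiftTm c (var j)) ≡⟨ cong (substTm (suc j) _) (shiftTm-var-≥ c≤j) ⟩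
  substTm (suc j) (shiftTm c N) (var (suc j))       ≡⟨ substTm-var-≡ {suc j} ⟩
  shiftTm c N                                       ≡⟨ cong (shiftTm c) (substTm-var-≡ {j}) ⟨
  shiftTm c (substTm j N (var j))                   ∎
... | inj₂ c≤x | tri> _ _ j<x@(s≤s j≤y) = begin
  substTm (suc j) (shiftTm c N) (shiftTm c (var x)) ≡⟨ cong (substTm (suc j) _) (shiftTm-var-≥ c≤x) ⟩
  substTm (suc j) (shiftTm c N) (var (suc x))       ≡⟨ substTm-var-> (s≤s j<x) ⟩
  var x                                             ≡⟨ shiftTm-var-≥ (≤-trans c≤j j≤y) ⟨
  shiftTm c (var (pred x))                          ≡⟨ cong (shiftTm c) (substTm-var-> j<x) ⟨
  shiftTm c (substTm j N (var x))                   ∎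
shiftTm-substTm {c} {j} {N} (lam M) c≤j = cong lam (begin
  substTm (suc (suc j)) (shiftTm 0 (shiftTm c N)) (shiftTm (suc c) M)
    ≡⟨ cong (λ N′ → substTm (suc (suc j)) N′ (shiftTm (suc c) M)) (shiftTm-shiftTm₀ N) ⟨
  substTm (suc (suc j)) (shiftTm (suc c) (shiftTm 0 N)) (shiftTm (suc c) M)
    ≡⟨ shiftTm-substTm M (s≤s c≤j) ⟩
  shiftTm (suc c) (substTm (suc j) (shiftTm 0 N) M) ∎)
shiftTm-substTm (M₁ · M₂) c≤j =
  cong₂ _·_ (shiftTm-substTm M₁ c≤j) (shiftTm-substTm M₂ c≤j)
shiftTm-substTm hole      c≤j = refl

shiftTm-substTm₀ : ∀ {j N} M →
  substTm (suc j) (shiftTm 0 N) (shiftTm 0 M) ≡ shiftTm 0 (substTm j N M)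
shiftTm-substTm₀ M = shiftTm-substTm M z≤n

-- Hole-free terms and plugging

data HoleFree : Tm → Set where
  var : ∀ {x} → HoleFree (var x)
  lam : ∀ {M} → HoleFree M → HoleFree (lam M)
  _·_ : ∀ {M N} → HoleFree M → HoleFree N → HoleFree (M · N)

⊢⇒HoleFree : ∀ {Γ M A} → Γ ⊢ M ∶ A → HoleFree M
⊢⇒HoleFree (⊢var _)     = var
⊢⇒HoleFree (⊢lam ⊢M)    = lam (⊢⇒HoleFree ⊢M)
⊢⇒HoleFree (⊢app ⊢M ⊢N) = ⊢⇒HoleFree ⊢M · ⊢⇒HoleFree ⊢N

HoleFree-shiftTm : ∀ {c M} → HoleFree M → HoleFree (shiftTm c M)
HoleFree-shiftTm {c} {var x} var with x <ᵇ c
... | true  = var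
... | false = var
HoleFree-shiftTm (lam hM)  = lam (HoleFree-shiftTm hM)
HoleFree-shiftTm (hM · hN) = HoleFree-shiftTm hM · HoleFree-shiftTm hN

HoleFree-unshiftTm : ∀ {c} M → HoleFree (shiftTm c M) → HoleFree M
HoleFree-unshiftTm (var x) _         = var
HoleFree-unshiftTm (lam M) (lam hM)  = lam (HoleFree-unshiftTm M hM)
HoleFree-unshiftTm (M · N) (hM · hN) = HoleFree-unshiftTm M hM · HoleFree-unshiftTm N hN
HoleFree-unshiftTm hole    ()

HoleFree-substTm : ∀ {j N M} → HoleFree N → HoleFree M → HoleFree (substTm j N M)
HoleFree-substTm {j} {M = var x} hN var with x <ᵇ j | x ≡ᵇ j
... | true  | _     = var
... | false | true  = hN
... | false | false = var
HoleFree-substTm hN (lam hM)   = lam (HoleFree-substTm (HoleFree-shiftTm hN) hM)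
HoleFree-substTm hN (hM · hM′) = HoleFree-substTm hN hM · HoleFree-substTm hN hM′

plug-HoleFree : ∀ {M} X → HoleFree M → plug M X ≡ M
plug-HoleFree X var       = refl
plug-HoleFree X (lam hM)  = cong lam (plug-HoleFree _ hM)
plug-HoleFree X (hM · hN) = cong₂ _·_ (plug-HoleFree X hM) (plug-HoleFree X hN)

shiftTm-plug : ∀ {c} C X → shiftTm c (plug C X) ≡ plug (shiftTm c C) (shiftTm c X)
shiftTm-plug {c} (var x) X with x <ᵇ c
... | true  = refl
... | false = refl
shiftTm-plug {c} (lam C) X = cong lam (begin
  shiftTm (suc c) (plug C (shiftTm 0 X))
    ≡⟨ shiftTm-plug C (shiftTm 0 X) ⟩
  plug (shiftTm (suc c) C) (shiftTm (suc c) (shiftTm 0 X))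
    ≡⟨ cong (plug (shiftTm (suc c) C)) (shiftTm-shiftTm₀ X) ⟩
  plug (shiftTm (suc c) C) (shiftTm 0 (shiftTm c X)) ∎)
shiftTm-plug (C₁ · C₂) X = cong₂ _·_ (shiftTm-plug C₁ X) (shiftTm-plug C₂ X)
shiftTm-plug hole      X = refl

plug-assoc : ∀ C D X → plug (plug C D) X ≡ plug C (plug D X)
plug-assoc (var x)   D X = refl
plug-assoc (lam C)   D X = cong lam (begin
  plug (plug C (shiftTm 0 D)) (shiftTm 0 X) ≡⟨ plug-assoc C (shiftTm 0 D) (shiftTm 0 X) ⟩
  plug C (plug (shiftTm 0 D) (shiftTm 0 X)) ≡⟨ cong (plug C) (shiftTm-plug D X) ⟨
  plug C (shiftTm 0 (plug D X))             ∎)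
plug-assoc (C₁ · C₂) D X = cong₂ _·_ (plug-assoc C₁ D X) (plug-assoc C₂ D X)
plug-assoc hole      D X = refl

substTm-plug : ∀ {j N} C X → HoleFree N →
  substTm j N (plug C X) ≡ plug (substTm j N C) (substTm j N X)
substTm-plug {j} {N} (var x) X hN =
  sym (plug-HoleFree _ (HoleFree-substTm {j} {N} {var x} hN var))
substTm-plug {j} {N} (lam C) X hN = cong lam (begin
  substTm (suc j) (shiftTm 0 N) (plug C (shiftTm 0 X))
    ≡⟨ substTm-plug C (shiftTm 0 X) (HoleFree-shiftTm hN) ⟩
  plug (substTm (suc j) (shiftTm 0 N) C) (substTm (suc j) (shiftTm 0 N) (shiftTm 0 X))
    ≡⟨ cong (plug (substTm (suc j) (shiftTm 0 N) C)) (shiftTm-substTm₀ X) ⟩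
  plug (substTm (suc j) (shiftTm 0 N) C) (shiftTm 0 (substTm j N X)) ∎)
substTm-plug (C₁ · C₂) X hN = cong₂ _·_ (substTm-plug C₁ X hN) (substTm-plug C₂ X hN)
substTm-plug hole      X hN = refl

substTm-plug-shiftTm : ∀ {j N} C X →
  substTm j N (plug (shiftTm j C) X) ≡ plug C (substTm j N X)
substTm-plug-shiftTm {j} {N} (var x) X with <-≤-connex x j
... | inj₁ x<j = trans (cong (λ C → substTm j N (plug C X)) (shiftTm-var-< x<j)) (substTm-var-< x<j)
... | inj₂ j≤x = trans (cong (λ C → substTm j N (plug C X)) (shiftTm-var-≥ j≤x))
                      (substTm-var-> (s≤s j≤x))
substTm-plug-shiftTm {j} {N} (lam C) X = cong lam (begin
  substTm (suc j) (shiftTm 0 N) (plug (shiftTm (suc j) C) (shiftTm 0 X))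
    ≡⟨ substTm-plug-shiftTm C (shiftTm 0 X) ⟩
  plug C (substTm (suc j) (shiftTm 0 N) (shiftTm 0 X))
    ≡⟨ cong (plug C) (shiftTm-substTm₀ X) ⟩
  plug C (shiftTm 0 (substTm j N X)) ∎)
substTm-plug-shiftTm (C₁ · C₂) X =
  cong₂ _·_ (substTm-plug-shiftTm C₁ X) (substTm-plug-shiftTm C₂ X)
substTm-plug-shiftTm hole      X = refl

plug-argFrame : ∀ C N X → HoleFree N → plug (plug C (hole · N)) X ≡ plug C (X · N)
plug-argFrame C N X hN =
  trans (plug-assoc C (hole · N) X) (cong (λ N′ → plug C (X · N′)) (plug-HoleFree X hN))

plug-funFrame : ∀ C M X → HoleFree M → plug (plug C (M · hole)) X ≡ plug C (M · X)
plug-funFrame C M X hM =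
  trans (plug-assoc C (M · hole) X) (cong (λ M′ → plug C (M′ · X)) (plug-HoleFree X hM))

Value-shiftTm : ∀ {c V} → Value V → Value (shiftTm c V)
Value-shiftTm {c} (vvar {x}) with x <ᵇ c
... | true  = vvar
... | false = vvar
Value-shiftTm vlam = vlam

Value-substTm : ∀ {j N V} → Value N → Value V → Value (substTm j N V)
Value-substTm {j} vN (vvar {x}) with x <ᵇ j | x ≡ᵇ j
... | true  | _     = vvar
... | false | true  = vN
... | false | false = vvar
Value-substTm vN vlam = vlam

-- Call-by-Name simulation

skP-id : ∀ s p → skP s p ≡ p
skP-id s (pvar x)   = refl
skP-id s (λ⟨x,k⟩ u) = refl
skP-id s (λk u)     = refl

shP-ⁿ : ∀ {c M} → HoleFree M → shP c (M ⁿ) ≡ (shiftTm c M) ⁿ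
shP-ⁿ {c} {var x} var with x <ᵇ c
... | true  = refl
... | false = refl
shP-ⁿ (lam hM)  = cong (λ p → λ⟨x,k⟩ (kv ⨾ p)) (shP-ⁿ hM)
shP-ⁿ (hM · hN) = cong₂ (λ p p′ → λk (⟨ p′ , kv ⟩ ⨾ p)) (shP-ⁿ hM) (shP-ⁿ hN)

sbP-ⁿ : ∀ {j N M} → HoleFree N → HoleFree M → sbP j (N ⁿ) (M ⁿ) ≡ (substTm j N M) ⁿ
sbP-ⁿ {j} {N} {var x} hN var with x <ᵇ j | x ≡ᵇ j
... | true  | _     = refl
... | false | true  = refl
... | false | false = refl
sbP-ⁿ {j} {N} {lam M} hN (lam hM) = cong (λ p → λ⟨x,k⟩ (kv ⨾ p))
  (trans (cong (λ r → sbP (suc j) r (M ⁿ)) (shP-ⁿ hN)) (sbP-ⁿ (HoleFree-shiftTm hN) hM))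
sbP-ⁿ hN (hM · hM′) = cong₂ (λ p p′ → λk (⟨ p′ , kv ⟩ ⨾ p)) (sbP-ⁿ hN hM) (sbP-ⁿ hN hM′)

readback-ⁿ : ∀ {M} → HoleFree M → ⌊ M ⁿ ⌋P ≡ M
readback-ⁿ var      = refl
readback-ⁿ (lam hM) = cong lam (readback-ⁿ hM)
readback-ⁿ {M · N} (hM · hN) rewrite readback-ⁿ hM | readback-ⁿ hN =
  cong (M ·_) (plug-HoleFree M hN)

data CbNStack : T → Tm → Set where
  []  : CbNStack ⋆ hole
  _∷_ : ∀ {N t C} → HoleFree N → CbNStack t C → CbNStack ⟨ N ⁿ , t ⟩ (plug C (hole · N))

readback-CbNStack : ∀ {t C} → CbNStack t C → ⌊ t ⌋T ≡ C
readback-CbNStack []          = refl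
readback-CbNStack (hN ∷ args) rewrite readback-CbNStack args | readback-ⁿ hN = refl

→N-plug : ∀ {t C X Y} → CbNStack t C → X →N Y → plug C X →N plug C Y
→N-plug [] X→Y = X→Y
→N-plug {X = X} {Y} (_∷_ {N} {C = C} hN args) X→Y =
  subst₂ _→N_ (sym (plug-argFrame C N X hN)) (sym (plug-argFrame C N Y hN)) (→N-plug args (appN X→Y))

data CbNState (M₀ : Tm) : E → Set where
  state : ∀ {M t C} → HoleFree M → CbNStack t C → M₀ →N* plug C M → CbNState M₀ (t ⨾ (M ⁿ))

CbNState-step : ∀ {M₀ u u′} → CbNState M₀ u → u ⟶ u′ → CbNState M₀ u′
CbNState-step (state var [] _) ()
CbNState-step (state var (_ ∷ _) _) ()
CbNState-step (state (lam _) [] _) ()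
CbNState-step (state {lam M} (lam hM) (_∷_ {N} {t} {C} hN args) M₀↠) (r-pairλxk _)
  rewrite skP-id t (sbP 0 (N ⁿ) (M ⁿ)) | sbP-ⁿ {0} hN hM =
  state (HoleFree-substTm hN hM) args (M₀↠ ◅◅ β-step ◅ ε)
  where
  β-step : plug (plug C (hole · N)) (lam M) →N plug C (M [ N /0])
  β-step = subst (_→N plug C (M [ N /0])) (sym (plug-argFrame C N (lam M) hN)) (→N-plug args βN)
CbNState-step {M₀} (state {M · N} (hM · hN) [] M₀↠) r-⋆λk
  rewrite skP-id ⋆ (N ⁿ) | skP-id ⋆ (M ⁿ) =
  state hM (hN ∷ []) (subst (M₀ →N*_) (sym (plug-argFrame hole N M hN)) M₀↠)
CbNState-step {M₀} (state {M · N} (hM · hN) (_∷_ {N′} {t} {C} hN′ args) M₀↠) (r-pairλk _)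
  rewrite skP-id ⟨ N′ ⁿ , t ⟩ (N ⁿ) | skP-id ⟨ N′ ⁿ , t ⟩ (M ⁿ) =
  state hM (hN ∷ (hN′ ∷ args))
    (subst (M₀ →N*_) (sym (plug-argFrame (plug C (hole · N′)) N M hN)) M₀↠)

readback-CbNState : ∀ {M₀ u} → CbNState M₀ u → M₀ →N* ⌊ u ⌋E
readback-CbNState (state hM args M₀↠) rewrite readback-CbNStack args | readback-ⁿ hM = M₀↠

-- Call-by-Value simulation

skQ-id : ∀ s q → skQ s q ≡ q
skQ-id s (λ̄k u) = refl

-- Relational form of q ≡ M ᵛ: closure under shifting and under substitution of
-- values then needs no commutation lemmas for shQ and sbQ.
data CbVTerm : Q → Tm → Set where
  var : ∀ {x} → CbVTerm (λ̄k (kv ⨾ pvar x)) (var x)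
  lam : ∀ {q M} → CbVTerm q M → CbVTerm (λ̄k (kv ⨾ λ⟨x,k⟩ (q ∙ kv))) (lam M)
  app : ∀ {qM M qN N} → CbVTerm qM (shiftTm 0 M) → CbVTerm qN N →
        CbVTerm (λ̄k (qN ∙ λx (qM ∙ ⟨ pvar 0 , kv ⟩))) (M · N)

data CbVValue : P → Tm → Set where
  var : ∀ {x} → CbVValue (pvar x) (var x)
  lam : ∀ {q M} → CbVTerm q M → CbVValue (λ⟨x,k⟩ (q ∙ kv)) (lam M)

CbVTerm-HoleFree : ∀ {q M} → CbVTerm q M → HoleFree M
CbVTerm-HoleFree var                 = var
CbVTerm-HoleFree (lam qM)            = lam (CbVTerm-HoleFree qM)
CbVTerm-HoleFree (app {M = M} qM qN) =
  HoleFree-unshiftTm M (CbVTerm-HoleFree qM) · CbVTerm-HoleFree qN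

CbVValue-HoleFree : ∀ {p V} → CbVValue p V → HoleFree V
CbVValue-HoleFree var      = var
CbVValue-HoleFree (lam qM) = lam (CbVTerm-HoleFree qM)

CbVValue-Value : ∀ {p V} → CbVValue p V → Value V
CbVValue-Value var     = vvar
CbVValue-Value (lam _) = vlam

CbVValue-CbVTerm : ∀ {p V} → CbVValue p V → CbVTerm (λ̄k (kv ⨾ p)) V
CbVValue-CbVTerm var      = var
CbVValue-CbVTerm (lam qM) = lam qM

CbVTerm-shift : ∀ {c q M} → CbVTerm q M → CbVTerm (shQ c q) (shiftTm c M)
CbVTerm-shift {c} (var {x}) with x <ᵇ c
... | true  = var
... | false = var
CbVTerm-shift (lam qM) = lam (CbVTerm-shift qM)
CbVTerm-shift {c} (app {M = M} qM qN) =
  app (subst (CbVTerm _) (shiftTm-shiftTm₀ M) (CbVTerm-shift qM)) (CbVTerm-shift qN)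

CbVValue-shift : ∀ {c p V} → CbVValue p V → CbVValue (shP c p) (shiftTm c V)
CbVValue-shift {c} (var {x}) with x <ᵇ c
... | true  = var
... | false = var
CbVValue-shift (lam qM) = lam (CbVTerm-shift qM)

CbVTerm-subst : ∀ {j p V q M} → CbVValue p V → CbVTerm q M → CbVTerm (sbQ j p q) (substTm j V M)
CbVTerm-subst {j} pV (var {x}) with x <ᵇ j | x ≡ᵇ j
... | true  | _     = var
... | false | true  = CbVValue-CbVTerm pV
... | false | false = var
CbVTerm-subst pV (lam qM) = lam (CbVTerm-subst (CbVValue-shift pV) qM)
CbVTerm-subst pV (app {M = M} qM qN) =
  app (subst (CbVTerm _) (shiftTm-substTm₀ M) (CbVTerm-subst (CbVValue-shift pV) qM))
      (CbVTerm-subst pV qN)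

CbVValue-subst : ∀ {j p V p′ V′} → CbVValue p V → CbVValue p′ V′ →
  CbVValue (sbP j p p′) (substTm j V V′)
CbVValue-subst {j} pV (var {x}) with x <ᵇ j | x ≡ᵇ j
... | true  | _     = var
... | false | true  = pV
... | false | false = var
CbVValue-subst pV (lam qM) = lam (CbVTerm-subst (CbVValue-shift pV) qM)

CbVTerm-ᵛ : ∀ {M} → HoleFree M → CbVTerm (M ᵛ) M
CbVTerm-ᵛ var       = var
CbVTerm-ᵛ (lam hM)  = lam (CbVTerm-ᵛ hM)
CbVTerm-ᵛ (hM · hN) = app (CbVTerm-shift (CbVTerm-ᵛ hM)) (CbVTerm-ᵛ hN)

data CbVContext : Tm → Set where
  hole : CbVContext hole
  fun  : ∀ {C M} → CbVContext C → HoleFree M → CbVContext (plug C (M · hole))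
  arg  : ∀ {C V} → CbVContext C → Value V → HoleFree V → CbVContext (plug C (hole · V))

CbVContext-shift : ∀ {c C} → CbVContext C → CbVContext (shiftTm c C)
CbVContext-shift hole = hole
CbVContext-shift (fun {C} {M} E hM) =
  subst CbVContext (sym (shiftTm-plug C (M · hole))) (fun (CbVContext-shift E) (HoleFree-shiftTm hM))
CbVContext-shift (arg {C} {V} E vV hV) =
  subst CbVContext (sym (shiftTm-plug C (hole · V)))
    (arg (CbVContext-shift E) (Value-shiftTm vV) (HoleFree-shiftTm hV))

CbVContext-subst : ∀ {j N C} → Value N → HoleFree N → CbVContext C → CbVContext (substTm j N C)
CbVContext-subst vN hN hole = hole
CbVContext-subst vN hN (fun {C} {M} E hM) =
  subst CbVContext (sym (substTm-plug C (M · hole) hN))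
    (fun (CbVContext-subst vN hN E) (HoleFree-substTm hN hM))
CbVContext-subst vN hN (arg {C} {V} E vV hV) =
  subst CbVContext (sym (substTm-plug C (hole · V) hN))
    (arg (CbVContext-subst vN hN E) (Value-substTm vN vV) (HoleFree-substTm hN hV))

→V-plug : ∀ {C X Y} → CbVContext C → X →V Y → plug C X →V plug C Y
→V-plug hole X→Y = X→Y
→V-plug {X = X} {Y} (fun {C} {M} E hM) X→Y =
  subst₂ _→V_ (sym (plug-funFrame C M X hM)) (sym (plug-funFrame C M Y hM)) (→V-plug E (argV X→Y))
→V-plug {X = X} {Y} (arg {C} {V} E vV hV) X→Y =
  subst₂ _→V_ (sym (plug-argFrame C V X hV)) (sym (plug-argFrame C V Y hV)) (→V-plug E (funV vV X→Y))

data CbVCont : T → Tm → Set where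
  []  : CbVCont ⋆ hole
  fun : ∀ {q M t C} → CbVTerm q (shiftTm 0 M) → CbVCont t (shiftTm 0 C) → CbVContext C →
        CbVCont (λx (q ∙ ⟨ pvar 0 , t ⟩)) (plug C (M · hole))
  arg : ∀ {p V t C} → CbVValue p V → CbVCont t C → CbVCont ⟨ p , t ⟩ (plug C (hole · V))

CbVCont-CbVContext : ∀ {t C} → CbVCont t C → CbVContext C
CbVCont-CbVContext []                   = hole
CbVCont-CbVContext (fun {M = M} qM _ E) = fun E (HoleFree-unshiftTm M (CbVTerm-HoleFree qM))
CbVCont-CbVContext (arg pV K)           =
  arg (CbVCont-CbVContext K) (CbVValue-Value pV) (CbVValue-HoleFree pV)

CbVCont-shift : ∀ {c t C} → CbVCont t C → CbVCont (shT c t) (shiftTm c C)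
CbVCont-shift [] = []
CbVCont-shift {c} (fun {M = M} {C = C} qM K E) =
  subst (CbVCont _) (sym (shiftTm-plug C (M · hole)))
    (fun (subst (CbVTerm _) (shiftTm-shiftTm₀ M) (CbVTerm-shift qM))
         (subst (CbVCont _) (shiftTm-shiftTm₀ C) (CbVCont-shift K))
         (CbVContext-shift E))
CbVCont-shift (arg {V = V} {C = C} pV K) =
  subst (CbVCont _) (sym (shiftTm-plug C (hole · V))) (arg (CbVValue-shift pV) (CbVCont-shift K))

CbVCont-subst : ∀ {j p V t C} → CbVValue p V → CbVCont t C → CbVCont (sbT j p t) (substTm j V C)
CbVCont-subst pV [] = []
CbVCont-subst pV (fun {M = M} {C = C} qM K E) =
  subst (CbVCont _) (sym (substTm-plug C (M · hole) (CbVValue-HoleFree pV)))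
    (fun (subst (CbVTerm _) (shiftTm-substTm₀ M) (CbVTerm-subst (CbVValue-shift pV) qM))
         (subst (CbVCont _) (shiftTm-substTm₀ C) (CbVCont-subst (CbVValue-shift pV) K))
         (CbVContext-subst (CbVValue-Value pV) (CbVValue-HoleFree pV) E))
CbVCont-subst pV (arg {V = V′} {C = C} pV′ K) =
  subst (CbVCont _) (sym (substTm-plug C (hole · V′) (CbVValue-HoleFree pV)))
    (arg (CbVValue-subst pV pV′) (CbVCont-subst pV K))

readback-CbVTerm : ∀ {q M} → CbVTerm q M → ⌊ q ⌋Q ≡ M
readback-CbVTerm var      = refl
readback-CbVTerm (lam qM) = cong lam (readback-CbVTerm qM)
readback-CbVTerm (app {M = M} {N = N} qM qN)
  rewrite readback-CbVTerm qM | readback-CbVTerm qN | substTm-shiftTm {0} {hole} M =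
  cong (_· N) (plug-HoleFree N (HoleFree-unshiftTm M (CbVTerm-HoleFree qM)))

readback-CbVValue : ∀ {p V} → CbVValue p V → ⌊ p ⌋P ≡ V
readback-CbVValue var      = refl
readback-CbVValue (lam qM) = cong lam (readback-CbVTerm qM)

readback-CbVCont : ∀ {t C} → CbVCont t C → ⌊ t ⌋T ≡ C
readback-CbVCont [] = refl
readback-CbVCont (fun {M = M} {C = C} qM K _)
  rewrite readback-CbVCont K | readback-CbVTerm qM = begin
  substTm 0 hole (plug (plug (shiftTm 0 C) (hole · var 0)) (shiftTm 0 M))
    ≡⟨ cong (substTm 0 hole) (plug-assoc (shiftTm 0 C) (hole · var 0) (shiftTm 0 M)) ⟩
  substTm 0 hole (plug (shiftTm 0 C) (shiftTm 0 M · var 0))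
    ≡⟨ substTm-plug-shiftTm C (shiftTm 0 M · var 0) ⟩
  plug C (substTm 0 hole (shiftTm 0 M) · hole)
    ≡⟨ cong (λ M′ → plug C (M′ · hole)) (substTm-shiftTm M) ⟩
  plug C (M · hole) ∎
readback-CbVCont (arg pV K) rewrite readback-CbVCont K | readback-CbVValue pV = refl

data CbVState (M₀ : Tm) : E → Set where
  eval   : ∀ {q M t C} → CbVTerm q M → CbVCont t C → M₀ →V* plug C M → CbVState M₀ (q ∙ t)
  return : ∀ {p V t C} → CbVValue p V → CbVCont t C → M₀ →V* plug C V → CbVState M₀ (t ⨾ p)

CbVState-step : ∀ {M₀ u u′} → CbVState M₀ u → u ⟶ u′ → CbVState M₀ u′
CbVState-step (eval var K M₀↠) (r-λ̄k _) = return var K M₀↠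
CbVState-step (eval (lam qM) K M₀↠) (r-λ̄k _) = return (lam qM) K M₀↠
CbVState-step {M₀} (eval {t = t} {C} (app {q} {M} {q′} {N} qM qN) K M₀↠) (r-λ̄k _)
  rewrite skQ-id t q′ | skQ-id (shT 0 t) q =
  eval qN (fun qM (CbVCont-shift K) (CbVCont-CbVContext K))
    (subst (M₀ →V*_) (sym (plug-funFrame C M N hM)) M₀↠)
  where
  hM : HoleFree M
  hM = HoleFree-unshiftTm M (CbVTerm-HoleFree qM)
CbVState-step (return var [] _) ()
CbVState-step (return (lam _) [] _) ()
CbVState-step {M₀} (return {V = V} pV (fun {M = M} {C = C} qM K _) M₀↠) (r-λx _) =
  eval (subst (CbVTerm _) (substTm-shiftTm M) (CbVTerm-subst pV qM))
    (arg pV (subst (CbVCont _) (substTm-shiftTm C) (CbVCont-subst pV K)))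
    (subst (M₀ →V*_) plug-swap M₀↠)
  where
  plug-swap : plug (plug C (M · hole)) V ≡ plug (plug C (hole · V)) M
  plug-swap = trans (plug-funFrame C M V (HoleFree-unshiftTm M (CbVTerm-HoleFree qM)))
                    (sym (plug-argFrame C V M (CbVValue-HoleFree pV)))
CbVState-step (return var (arg _ _) _) ()
CbVState-step (return (lam {q} {M} qM) (arg {p} {V} {t} {C} pV K) M₀↠) (r-pairλxk _)
  rewrite skQ-id t (sbQ 0 p q) =
  eval (CbVTerm-subst pV qM) K (M₀↠ ◅◅ β-step ◅ ε)
  where
  β-step : plug (plug C (hole · V)) (lam M) →V plug C (M [ V /0])
  β-step = subst (_→V plug C (M [ V /0]))
                 (sym (plug-argFrame C V (lam M) (CbVValue-HoleFree pV)))
                 (→V-plug (CbVCont-CbVContext K) (βV (CbVValue-Value pV)))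

readback-CbVState : ∀ {M₀ u} → CbVState M₀ u → M₀ →V* ⌊ u ⌋E
readback-CbVState (eval qM K M₀↠)   rewrite readback-CbVCont K | readback-CbVTerm qM  = M₀↠
readback-CbVState (return pV K M₀↠) rewrite readback-CbVCont K | readback-CbVValue pV = M₀↠

theorem4 : ∀ {Γ M A} → Γ ⊢ M ∶ A →
    (∀ u → (⋆ ⨾ (M ⁿ)) ⟶* u → M →N* ⌊ u ⌋E)
    × (∀ u → ((M ᵛ) ∙ ⋆) ⟶* u → M →V* ⌊ u ⌋E)
theorem4 {M = M} ⊢M =
    (λ u run → readback-CbNState
                 (preserved-by-Star (CbNState M) CbNState-step (state hM [] ε) run))
  , (λ u run → readback-CbVState
                 (preserved-by-Star (CbVState M) CbVState-step (eval (CbVTerm-ᵛ hM) [] ε) run))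
  where
  hM : HoleFree M
  hM = ⊢⇒HoleFree ⊢M
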